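{- Let $n\ge2$. The map sending each isolated word $w\in C_n^*$ to $(\mathrm{wt}(w),\mathrm{inv}(w))$ induces a bijection between the set of commutative (central) elements of $\mathrm{hypo}(\mathcal{C}_n)$ and the set of pairs $(\lambda,\delta)$ with $\lambda=(\lambda_1,\dots,\lambda_n)\in\mathbb{Z}^n$ and $\delta=(\delta_1,\dots,\delta_n)\in\{0,1\}^n$ satisfying: (1) if $\lambda_i\ne0$ for some $i\in\{1,\dots,n\}$, then $\delta_i=1$, and also $\delta_{i-1}=1$ when $i\ge2$; (2) if $\delta_i=1$ for some $i\in\{2,\dots,n\}$, then $\delta_{i-1}=1$, or $\delta_{i+1}=1$ when $i\le n-1$.
   Context: Let $n\ge2$ and $C_n=\{1<2<\cdots<n<\bar n<\overline{n-1}<\cdots<\bar 1\}$; $C_n^*$ is the free monoid of words over $C_n$ and $|w|_a$ the number of occurrences of the letter $a$ in $w$. Convention: the symbols $n+1$ and $\overline{n+1}$ never occur in any word. For $i\in\{1,\dots,n\}$, $w$ has an $i$-inversion if $w=w_1xw_2yw_3$ with $x\in\{i,\overline{i+1}\}$, $y\in\{i+1,\bar i\}$. Quasi-crystal structure on $C_n^*$: $\mathrm{wt}(w)=(|w|_1-|w|_{\bar1},\dots,|w|_n-|w|_{\bar n})\in\mathbb{Z}^n$. For $i\in\{1,\dots,n\}$: if $w$ has an $i$-inversion then $\ddot{\varepsilon}_i(w)=\ddot{\varphi}_i(w)=+\infty$ and $\ddot{e}_i(w),\ddot{f}_i(w)$ are undefined; otherwise $\ddot{\varepsilon}_i(w)=|w|_{i+1}+|w|_{\bar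 i}$, $\ddot{\varphi}_i(w)=|w|_i+|w|_{\overline{i+1}}$; $\ddot{e}_i(w)$ is defined iff $\ddot{\varepsilon}_i(w)>0$ and is obtained by replacing the right-most letter of $w$ lying in $\{i+1,\bar i\}$ by its image under the letter map $\ddot{e}_i$ ($i+1\mapsto i$, $\bar i\mapsto\overline{i+1}$ for $i<n$; $\bar n\mapsto n$ for $i=n$); $\ddot{f}_i(w)$ is defined iff $\ddot{\varphi}_i(w)>0$ and is obtained by replacing the left-most letter of $w$ lying in $\{i,\overline{i+1}\}$ by its image under the letter map $\ddot{f}_i$ ($i\mapsto i+1$, $\overline{i+1}\mapsto\bar i$ for $i<n$; $n\mapsto\bar n$ for $i=n$). The connected component $C_n^*(w)$ is the set of words obtained from $w$ by finitely many (defined) applications of the operators $\ddot{e}_i,\ddot{f}_i$; $w$ is isolated if $C_n^*(w)=\{w\}$. Hypoplactic congruence: $u\ddot{\sim}v$ iff there is a bijection $\psi:C_n^*(u)\to C_n^*(v)$ with $\psi(u)=v$ such that for all $x\in C_n^*(u)$ and $i$: $\psi(x)$ has the same $\mathrm{wt},\ddot{\varepsilon}_i,\ddot{\varphi}_i$ as $x$, $\ddot{e}_i(\psi(x))$ is defined iff $\ddot{e}_i(x)$ is (and then $\psi(\ddot{e}_i(x))=\ddot{e}_i(\psi(x))$), and likewise for $\ddot{f}_i$. It is a monoid congruence on $C_n^*$ and $\mathrm{hypo}(\mathcal{C}_n)=C_n^*/\ddot{\sim}$. For $w\in C_n^*$, $\mathrm{inv}(w)=(\delta_1,\dots,\delta_n)\in\{0,1\}^n$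 where $\delta_i=1$ iff $w$ has an $i$-inversion. -}

module Defs where

open import Data.Nat using (ℕ; zero; suc; _≡ᵇ_; _≤_)
open import Data.Integer using (ℤ; +_; _-_; 0ℤ)
open import Data.Fin using (Fin; zero; suc; toℕ)
open import Data.Bool using (Bool; true; false; _∧_; _∨_; if_then_else_)
open import Data.List using (List; []; _∷_; _++_; length; filterᵇ)
open import Data.Bool.ListAction using (any)
open import Data.Vec using (Vec; tabulate; lookup)
open import Data.Maybe using (Maybe; just; nothing) renaming (map to mapMaybe)
open import Data.Product using (Σ; ∃; ∃-syntax; _×_; _,_)
open import Data.Sum using (_⊎_)
open import Relation.Binary.PropositionalEquality using (_≡_; _≢_)

-- Letters of C_n : pos i is the letter (toℕ i + 1), neg i is its barred version.
data Letter (n : ℕ) : Set where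
  pos : Fin n → Letter n
  neg : Fin n → Letter n

Word : ℕ → Set
Word n = List (Letter n)

-- Operator indices i ∈ {1,…,n} are represented by Fin n (index i ↦ toℕ i + 1).

isA : ∀ {n} → Fin n → Letter n → Bool
isA i (pos j) = toℕ j ≡ᵇ toℕ i
isA i (neg j) = toℕ j ≡ᵇ suc (toℕ i)

isB : ∀ {n} → Fin n → Letter n → Bool
isB i (pos j) = toℕ j ≡ᵇ suc (toℕ i)
isB i (neg j) = toℕ j ≡ᵇ toℕ i

next : ∀ {n} → Fin n → Maybe (Fin n)
next {suc zero} zero = nothing
next {suc (suc _)} zero = just (suc zero)
next (suc i) = mapMaybe suc (next i)

-- letter map ë_i (only meaningful on letters in {i+1, bar i})
eL : ∀ {n} → Fin n → Letter n → Letter n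
eL i (pos _) = pos i
eL i (neg _) with next i
... | just k = neg k
... | nothing = pos i

-- letter map f̈_i (only meaningful on letters in {i, overline{i+1}})
fL : ∀ {n} → Fin n → Letter n → Letter n
fL i (pos _) with next i
... | just k = pos k
... | nothing = neg i
fL i (neg _) = neg i

isPos isNeg : ∀ {n} → Fin n → Letter n → Bool
isPos i (pos j) = toℕ j ≡ᵇ toℕ i
isPos i (neg j) = false
isNeg i (pos j) = false
isNeg i (neg j) = toℕ j ≡ᵇ toℕ i

countᵇ : ∀ {n} → (Letter n → Bool) → Word n → ℕ
countᵇ p w = length (filterᵇ p w)

wt : ∀ {n} → Word n → Vec ℤ n
wt w = tabulate (λ i → (+ countᵇ (isPos i) w) - (+ countᵇ (isNeg i) w))

hasInv : ∀ {n} → Fin n → Word n → Bool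
hasInv i [] = false
hasInv i (x ∷ w) = (isA i x ∧ any (isB i) w) ∨ hasInv i w

inv : ∀ {n} → Word n → Vec Bool n
inv w = tabulate (λ i → hasInv i w)

data ℕ∞ : Set where
  fin : ℕ → ℕ∞
  ∞ : ℕ∞

ε̈ φ̈ : ∀ {n} → Fin n → Word n → ℕ∞
ε̈ i w = if hasInv i w then ∞ else fin (countᵇ (isB i) w)
φ̈ i w = if hasInv i w then ∞ else fin (countᵇ (isA i) w)

replaceFirst : {A : Set} → (A → Bool) → (A → A) → List A → Maybe (List A)
replaceFirst p g [] = nothing
replaceFirst p g (x ∷ w) = if p x then just (g x ∷ w) else mapMaybe (x ∷_) (replaceFirst p g w)

replaceLast : {A : Set} → (A → Bool) → (A → A) → List A → Maybe (List A)
replaceLast p g [] = nothing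
replaceLast p g (x ∷ w) with replaceLast p g w
... | just w' = just (x ∷ w')
... | nothing = if p x then just (g x ∷ w) else nothing

-- ë_i and f̈_i on words (nothing = undefined)
ë f̈ : ∀ {n} → Fin n → Word n → Maybe (Word n)
ë i w = if hasInv i w then nothing else replaceLast (isB i) (eL i) w
f̈ i w = if hasInv i w then nothing else replaceFirst (isA i) (fL i) w

data Reach {n : ℕ} (u : Word n) : Word n → Set where
  here : Reach u u
  step-e : ∀ {x y} (i : Fin n) → Reach u x → ë i x ≡ just y → Reach u y
  step-f : ∀ {x y} (i : Fin n) → Reach u x → f̈ i x ≡ just y → Reach u y

Isolated : ∀ {n} → Word n → Set
Isolated w = ∀ x → Reach w x → x ≡ w

_∼̈_ : ∀ {n} → Word n → Word n → Set
_∼̈_ {n} u v = Σ (Word n → Word n) λ ψ →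
    (ψ u ≡ v)
  × (∀ x → Reach u x → Reach v (ψ x))
  × (∀ x y → Reach u x → Reach u y → ψ x ≡ ψ y → x ≡ y)
  × (∀ y → Reach v y → ∃[ x ] (Reach u x × ψ x ≡ y))
  × (∀ x → Reach u x →
       (wt (ψ x) ≡ wt x)
     × (∀ i → ε̈ i (ψ x) ≡ ε̈ i x)
     × (∀ i → φ̈ i (ψ x) ≡ φ̈ i x)
     × (∀ i → ë i (ψ x) ≡ mapMaybe ψ (ë i x))
     × (∀ i → f̈ i (ψ x) ≡ mapMaybe ψ (f̈ i x)))

Central : ∀ {n} → Word n → Set
Central w = ∀ u → (u ++ w) ∼̈ (w ++ u)

Admissible : ∀ {n} → Vec ℤ n → Vec Bool n → Set
Admissible {n} lam δ =
    (∀ (i : Fin n) → lookup lam i ≢ 0ℤ →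
        lookup δ i ≡ true × (∀ (j : Fin n) → suc (toℕ j) ≡ toℕ i → lookup δ j ≡ true))
  × (∀ (i : Fin n) → 1 ≤ toℕ i → lookup δ i ≡ true →
        (∃[ j ] (suc (toℕ j) ≡ toℕ i × lookup δ j ≡ true))
      ⊎ (∃[ j ] (toℕ j ≡ suc (toℕ i) × lookup δ j ≡ true)))

-- Call w i-inert if it has an i-inversion or contains no letter of
-- {i, overline{i+1}, i+1, ī}. A word is isolated iff it is i-inert for every i:
-- an i-inert word is fixed by ë_i and f̈_i, and otherwise one of them moves it.
-- Inert words are central: framing x by an i-inert w, as x w or w x, either makes
-- ë_i, f̈_i undefined on both sides or leaves their action on x unchanged, so
-- x w ↦ w x identifies the components of u w and w u. Conversely a central word
-- is inert, because ī w and w ī (resp. i w and w i) must have the same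
-- i-inversions. Isolated words with equal weight and inversions are trivially
-- congruent; the admissibility conditions record what a letter of nonzero
-- weight, resp. an i-inversion, forces on the inversions of an inert word. An
-- admissible (λ, δ) is realised by a dipole x x̄ carrying an i-inversion for
-- each i with δ_i = 1, followed by |λ_i| copies of i or ī for each i.

module Submission where

open import Defs
open import Data.Bool using (Bool; true; false; _∧_; _∨_; if_then_else_)
open import Data.Bool.Properties using (T-≡; ∨-assoc; ∨-zeroʳ; ∨-identityʳ; ∧-zeroʳ)
open import Data.Bool.ListAction using (any)
open import Data.Bool.Solver using (module ∨-∧-Solver)
open import Data.Empty using (⊥-elim)
open import Data.Fin using (Fin; zero; suc; toℕ; inject₁; _≟_)
open import Data.Fin.Properties using (toℕ-injective; toℕ-inject₁)
import Data.Fin.Properties as Fin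
open import Data.Integer using (ℤ; +_; -[1+_]; _+_; _-_; _*_; -_; 0ℤ; 1ℤ; -1ℤ)
open import Data.Integer.Properties using (pos-+)
import Data.Integer.Properties as ℤ
open import Data.Integer.Tactic.RingSolver using (solve-∀)
open import Data.List using (List; []; _∷_; _++_; [_]; length; filterᵇ; replicate; take)
open import Data.List.Properties using (length-++; filter-++; ++-cancelˡ; ∷-injectiveˡ; ∷-injectiveʳ)
open import Data.List.Membership.Propositional using (_∈_; find; lose)
open import Data.List.Relation.Unary.All using (All; []; _∷_)
import Data.List.Relation.Unary.All as All
open import Data.List.Relation.Unary.All.Properties using (++⁺; replicate⁺)
open import Data.List.Relation.Unary.Any using (here; there)
open import Data.List.Relation.Unary.Any.Properties using (any⁺; any⁻)
open import Data.Maybe using (Maybe; just; nothing) renaming (map to mapMaybe)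
open import Data.Maybe.Properties using (map-id; map-∘; map-cong)
open import Data.Nat using (ℕ; zero; suc; _≡ᵇ_; _∸_; s≤s; z≤n)
import Data.Nat as ℕ
open import Data.Nat.Properties using (≡ᵇ⇒≡; ≡⇒≡ᵇ; m+n∸n≡m)
import Data.Nat.Properties as ℕ
open import Data.Product using (_×_; ∃-syntax; _,_; proj₁; proj₂)
open import Data.Sum using (_⊎_; inj₁; inj₂)
open import Data.Vec using (Vec; lookup)
open import Data.Vec.Properties using (lookup∘tabulate; tabulate∘lookup; tabulate-cong)
import Data.Vec.Functional as Vector
open import Function using (_∘_; Equivalence)
open import Relation.Binary.PropositionalEquality
  using (_≡_; _≢_; refl; sym; trans; cong; cong₂; subst; module ≡-Reasoning)
open import Relation.Nullary using (yes; no)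
open import Relation.Nullary.Decidable using (T?)

lookup-extensionality : ∀ {A : Set} {n} {u v : Vec A n} → (∀ i → lookup u i ≡ lookup v i) → u ≡ v
lookup-extensionality {u = u} {v} h =
  trans (sym (tabulate∘lookup u)) (trans (tabulate-cong h) (tabulate∘lookup v))

≡ᵇ-sound : ∀ {m n} → (m ≡ᵇ n) ≡ true → m ≡ n
≡ᵇ-sound {m} {n} e = ≡ᵇ⇒≡ m n (Equivalence.from T-≡ e)

≡ᵇ-complete : ∀ {m n} → m ≡ n → (m ≡ᵇ n) ≡ true
≡ᵇ-complete {m} {n} e = Equivalence.to T-≡ (≡⇒≡ᵇ m n e)

≡ᵇ-refl : ∀ m → (m ≡ᵇ m) ≡ true
≡ᵇ-refl m = ≡ᵇ-complete {m} refl

1+n≡ᵇn : ∀ m → (suc m ≡ᵇ m) ≡ false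
1+n≡ᵇn zero = refl
1+n≡ᵇn (suc m) = 1+n≡ᵇn m

n≡ᵇ1+n : ∀ m → (m ≡ᵇ suc m) ≡ false
n≡ᵇ1+n zero = refl
n≡ᵇ1+n (suc m) = n≡ᵇ1+n m

false≢true : false ≢ true
false≢true ()

any-++ : ∀ {A : Set} (p : A → Bool) xs ys → any p (xs ++ ys) ≡ any p xs ∨ any p ys
any-++ p [] ys = refl
any-++ p (x ∷ xs) ys = trans (cong (p x ∨_) (any-++ p xs ys)) (sym (∨-assoc (p x) _ _))

any⇒∈ : ∀ {A : Set} {p : A → Bool} {xs} → any p xs ≡ true → ∃[ x ] (x ∈ xs × p x ≡ true)
any⇒∈ {p = p} {xs} e with find (any⁻ p xs (Equivalence.from T-≡ e))
... | x , x∈xs , px = x , x∈xs , Equivalence.to T-≡ px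

∈⇒any : ∀ {A : Set} {p : A → Bool} {x xs} → x ∈ xs → p x ≡ true → any p xs ≡ true
∈⇒any {p = p} x∈xs px = Equivalence.to T-≡ (any⁺ p (lose x∈xs (Equivalence.from T-≡ px)))

take-++ : ∀ {A : Set} (xs ys : List A) → take (length xs) (xs ++ ys) ≡ xs
take-++ [] ys = refl
take-++ (x ∷ xs) ys = cong (x ∷_) (take-++ xs ys)

map-just⁻ : ∀ {A B : Set} {f : A → B} {m y} → mapMaybe f m ≡ just y → ∃[ x ] (m ≡ just x × f x ≡ y)
map-just⁻ {m = just x} refl = x , refl , refl

module _ {A : Set} (p : A → Bool) (g : A → A) where

  replaceFirst-absent : ∀ xs → any p xs ≡ false → replaceFirst p g xs ≡ nothing
  replaceFirst-absent [] _ = refl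
  replaceFirst-absent (x ∷ xs) e with p x
  ... | false rewrite replaceFirst-absent xs e = refl

  replaceLast-absent : ∀ xs → any p xs ≡ false → replaceLast p g xs ≡ nothing
  replaceLast-absent [] _ = refl
  replaceLast-absent (x ∷ xs) e with p x in px
  ... | false rewrite replaceLast-absent xs e | px = refl

  replaceFirst-++ʳ : ∀ xs ys → any p ys ≡ false →
    replaceFirst p g (xs ++ ys) ≡ mapMaybe (_++ ys) (replaceFirst p g xs)
  replaceFirst-++ʳ [] ys e = replaceFirst-absent ys e
  replaceFirst-++ʳ (x ∷ xs) ys e with p x
  ... | true = refl
  ... | false rewrite replaceFirst-++ʳ xs ys e with replaceFirst p g xs
  ...   | just _ = refl
  ...   | nothing = refl

  replaceFirst-++ˡ : ∀ xs ys → any p xs ≡ false →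
    replaceFirst p g (xs ++ ys) ≡ mapMaybe (xs ++_) (replaceFirst p g ys)
  replaceFirst-++ˡ [] ys e = sym (map-id (replaceFirst p g ys))
  replaceFirst-++ˡ (x ∷ xs) ys e with p x
  ... | false rewrite replaceFirst-++ˡ xs ys e with replaceFirst p g ys
  ...   | just _ = refl
  ...   | nothing = refl

  replaceLast-++ʳ : ∀ xs ys → any p ys ≡ false →
    replaceLast p g (xs ++ ys) ≡ mapMaybe (_++ ys) (replaceLast p g xs)
  replaceLast-++ʳ [] ys e = replaceLast-absent ys e
  replaceLast-++ʳ (x ∷ xs) ys e rewrite replaceLast-++ʳ xs ys e with replaceLast p g xs
  ... | just _ = refl
  ... | nothing with p x
  ...   | true = refl
  ...   | false = refl

  replaceLast-++ˡ : ∀ xs ys → any p xs ≡ false →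
    replaceLast p g (xs ++ ys) ≡ mapMaybe (xs ++_) (replaceLast p g ys)
  replaceLast-++ˡ [] ys e = sym (map-id (replaceLast p g ys))
  replaceLast-++ˡ (x ∷ xs) ys e with p x in px
  ... | false rewrite replaceLast-++ˡ xs ys e with replaceLast p g ys
  ...   | just _ = refl
  ...   | nothing rewrite px = refl

  replaceLast-defined : ∀ xs → any p xs ≡ true → replaceLast p g xs ≢ nothing
  replaceLast-defined (x ∷ xs) e with replaceLast p g xs in eq
  ... | just _ = λ ()
  ... | nothing with p x
  ...   | true = λ ()
  ...   | false = λ _ → replaceLast-defined xs e eq

  module _ (g-leaves : ∀ x → p (g x) ≡ false) where

    replaceFirst-moves : ∀ xs → any p xs ≡ true → ∃[ ys ] (replaceFirst p g xs ≡ just ys × ys ≢ xs)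
    replaceFirst-moves (x ∷ xs) e with p x in px
    ... | true = g x ∷ xs , refl ,
          λ eq → false≢true (trans (sym (g-leaves x)) (trans (cong p (∷-injectiveˡ eq)) px))
    ... | false with replaceFirst-moves xs e
    ...   | ys , eq , ys≢xs rewrite eq = x ∷ ys , refl , ys≢xs ∘ ∷-injectiveʳ

    replaceLast-≢ : ∀ xs {ys} → replaceLast p g xs ≡ just ys → ys ≢ xs
    replaceLast-≢ (x ∷ xs) e with replaceLast p g xs in eq
    replaceLast-≢ (x ∷ xs) refl | just ys = replaceLast-≢ xs eq ∘ ∷-injectiveʳ
    ... | nothing with p x in px
    replaceLast-≢ (x ∷ xs) refl | nothing | true =
      λ eq′ → false≢true (trans (sym (g-leaves x)) (trans (cong p (∷-injectiveˡ eq′)) px))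

    replaceLast-moves : ∀ xs → any p xs ≡ true → ∃[ ys ] (replaceLast p g xs ≡ just ys × ys ≢ xs)
    replaceLast-moves xs e with replaceLast p g xs in eq
    ... | just ys = ys , refl , replaceLast-≢ xs eq
    ... | nothing = ⊥-elim (replaceLast-defined xs e eq)

private variable n : ℕ

index : Letter n → Fin n
index (pos j) = j
index (neg j) = j

bar : Letter n → Letter n
bar (pos j) = neg j
bar (neg j) = pos j

index-bar : ∀ (x : Letter n) → index (bar x) ≡ index x
index-bar (pos _) = refl
index-bar (neg _) = refl

isB-bar : ∀ (i : Fin n) x → isB i (bar x) ≡ isA i x
isB-bar i (pos _) = refl
isB-bar i (neg _) = refl

next-toℕ : ∀ (i k : Fin n) → next i ≡ just k → toℕ k ≡ suc (toℕ i)
next-toℕ {suc (suc _)} zero .(suc zero) refl = refl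
next-toℕ (suc i) k e with next i in eq
next-toℕ (suc i) .(suc k) refl | just k = cong suc (next-toℕ i k eq)

fL-leaves-A : ∀ (i : Fin n) x → isA i (fL i x) ≡ false
fL-leaves-A i (pos _) with next i in eq
... | just k rewrite next-toℕ i k eq = 1+n≡ᵇn (toℕ i)
... | nothing = n≡ᵇ1+n (toℕ i)
fL-leaves-A i (neg _) = n≡ᵇ1+n (toℕ i)

eL-leaves-B : ∀ (i : Fin n) x → isB i (eL i x) ≡ false
eL-leaves-B i (pos _) = n≡ᵇ1+n (toℕ i)
eL-leaves-B i (neg _) with next i in eq
... | just k rewrite next-toℕ i k eq = 1+n≡ᵇn (toℕ i)
... | nothing = n≡ᵇ1+n (toℕ i)

Touches : Fin n → Letter n → Set
Touches i x = isA i x ≡ true ⊎ isB i x ≡ true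

touches-index : ∀ (x : Letter n) → Touches (index x) x
touches-index (pos j) = inj₁ (≡ᵇ-refl (toℕ j))
touches-index (neg j) = inj₂ (≡ᵇ-refl (toℕ j))

touches-predecessor : ∀ (k : Fin n) x → suc (toℕ k) ≡ toℕ (index x) → Touches k x
touches-predecessor k (pos j) e = inj₂ (≡ᵇ-complete (sym e))
touches-predecessor k (neg j) e = inj₁ (≡ᵇ-complete (sym e))

touches⇒index : ∀ {k : Fin n} x → Touches k x → index x ≡ k ⊎ toℕ (index x) ≡ suc (toℕ k)
touches⇒index (pos j) (inj₁ e) = inj₁ (toℕ-injective (≡ᵇ-sound e))
touches⇒index (pos j) (inj₂ e) = inj₂ (≡ᵇ-sound e)
touches⇒index (neg j) (inj₁ e) = inj₂ (≡ᵇ-sound e)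
touches⇒index (neg j) (inj₂ e) = inj₁ (toℕ-injective (≡ᵇ-sound e))

module _ (i : Fin n) where

  hasInv-++ : ∀ x y → hasInv i (x ++ y) ≡ hasInv i x ∨ (any (isA i) x ∧ any (isB i) y) ∨ hasInv i y
  hasInv-++ [] y = refl
  hasInv-++ (a ∷ x) y rewrite any-++ (isB i) x y | hasInv-++ x y =
    distribute (isA i a) (any (isB i) x) (any (isB i) y) (hasInv i x) (any (isA i) x) (hasInv i y)
    where
    open ∨-∧-Solver
    distribute : ∀ a bx by hx ax hy →
      (a ∧ (bx ∨ by)) ∨ (hx ∨ (ax ∧ by) ∨ hy) ≡ ((a ∧ bx) ∨ hx) ∨ ((a ∨ ax) ∧ by) ∨ hy
    distribute = solve 6 (λ a bx by hx ax hy →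
      ((a :* (bx :+ by)) :+ (hx :+ ((ax :* by) :+ hy))) := (((a :* bx) :+ hx) :+ (((a :+ ax) :* by) :+ hy))) refl

  hasInv-++ˡ : ∀ x y → hasInv i x ≡ true → hasInv i (x ++ y) ≡ true
  hasInv-++ˡ x y hx rewrite hasInv-++ x y | hx = refl

  hasInv-++ʳ : ∀ x y → hasInv i y ≡ true → hasInv i (x ++ y) ≡ true
  hasInv-++ʳ x y hy rewrite hasInv-++ x y | hy | ∨-zeroʳ (any (isA i) x ∧ any (isB i) y) = ∨-zeroʳ (hasInv i x)

  hasInv-++-straddle : ∀ x y → any (isA i) x ≡ true → any (isB i) y ≡ true → hasInv i (x ++ y) ≡ true
  hasInv-++-straddle x y ax by rewrite hasInv-++ x y | ax | by = ∨-zeroʳ (hasInv i x)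

  hasInv-∷-¬A : ∀ a w → isA i a ≡ false → hasInv i (a ∷ w) ≡ hasInv i w
  hasInv-∷-¬A a w e rewrite e = refl

  hasInv-∷ʳ-¬B : ∀ w a → isB i a ≡ false → hasInv i (w ++ [ a ]) ≡ hasInv i w
  hasInv-∷ʳ-¬B w a e rewrite hasInv-++ w [ a ] | e | ∧-zeroʳ (any (isA i) w) | ∧-zeroʳ (isA i a) =
    ∨-identityʳ (hasInv i w)

  hasInv⇒A-letter : ∀ w → hasInv i w ≡ true → ∃[ x ] (x ∈ w × isA i x ≡ true)
  hasInv⇒A-letter (a ∷ w) e with isA i a in ea
  ... | true = a , here refl , ea
  ... | false with hasInv⇒A-letter w e
  ...   | x , x∈w , ex = x , there x∈w , ex

  ë-uninverted : ∀ w → hasInv i w ≡ false → ë i w ≡ replaceLast (isB i) (eL i) w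
  ë-uninverted w e rewrite e = refl

  f̈-uninverted : ∀ w → hasInv i w ≡ false → f̈ i w ≡ replaceFirst (isA i) (fL i) w
  f̈-uninverted w e rewrite e = refl

-- Isolated words

Inert : Fin n → Word n → Set
Inert i w = hasInv i w ≡ false → any (isA i) w ≡ false × any (isB i) w ≡ false

inert-touch : ∀ {i : Fin n} {w x} → Inert i w → x ∈ w → Touches i x → hasInv i w ≡ true
inert-touch {i = i} {w} inert x∈w t with hasInv i w in e
... | true = refl
... | false with inert refl | t
...   | noA , _ | inj₁ a = ⊥-elim (false≢true (trans (sym noA) (∈⇒any x∈w a)))
...   | _ , noB | inj₂ b = ⊥-elim (false≢true (trans (sym noB) (∈⇒any x∈w b)))

inert⇒stuck : ∀ (i : Fin n) w → Inert i w → ë i w ≡ nothing × f̈ i w ≡ nothing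
inert⇒stuck i w inert with hasInv i w in e
... | true = refl , refl
... | false = replaceLast-absent (isB i) (eL i) w (proj₂ (inert refl))
            , replaceFirst-absent (isA i) (fL i) w (proj₁ (inert refl))

stuck⇒isolated : ∀ {w : Word n} → (∀ i → ë i w ≡ nothing × f̈ i w ≡ nothing) → Isolated w
stuck⇒isolated stuck _ here = refl
stuck⇒isolated stuck _ (step-e i r e) with stuck⇒isolated stuck _ r
... | refl with trans (sym e) (proj₁ (stuck i))
...   | ()
stuck⇒isolated stuck _ (step-f i r e) with stuck⇒isolated stuck _ r
... | refl with trans (sym e) (proj₂ (stuck i))
...   | ()

inert⇒isolated : ∀ {w : Word n} → (∀ i → Inert i w) → Isolated w
inert⇒isolated {w = w} inert = stuck⇒isolated (λ i → inert⇒stuck i w (inert i))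

isolated⇒inert : ∀ {w : Word n} → Isolated w → ∀ i → Inert i w
isolated⇒inert {w = w} isolated i noInv = absentA , absentB
  where
  absentA : any (isA i) w ≡ false
  absentA with any (isA i) w in ea
  ... | false = refl
  ... | true with replaceFirst-moves (isA i) (fL i) (fL-leaves-A i) w ea
  ...   | y , fy , y≢w = ⊥-elim (y≢w (isolated y (step-f i here (trans (f̈-uninverted i w noInv) fy))))
  absentB : any (isB i) w ≡ false
  absentB with any (isB i) w in eb
  ... | false = refl
  ... | true with replaceLast-moves (isB i) (eL i) (eL-leaves-B i) w eb
  ...   | y , ey , y≢w = ⊥-elim (y≢w (isolated y (step-e i here (trans (ë-uninverted i w noInv) ey))))

countᵇ-++ : ∀ (p : Letter n → Bool) x y → countᵇ p (x ++ y) ≡ countᵇ p x ℕ.+ countᵇ p y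
countᵇ-++ p x y = trans (cong length (filter-++ (T? ∘ p) x y)) (length-++ (filterᵇ p x))

countᵇ-absent : ∀ (p : Letter n → Bool) w → any p w ≡ false → countᵇ p w ≡ 0
countᵇ-absent p [] _ = refl
countᵇ-absent p (x ∷ w) e with p x
countᵇ-absent p (x ∷ w) () | true
... | false = countᵇ-absent p w e

wt-lookup : ∀ (w : Word n) k → lookup (wt w) k ≡ (+ countᵇ (isPos k) w) - (+ countᵇ (isNeg k) w)
wt-lookup w = lookup∘tabulate _

wt-[] : ∀ (k : Fin n) → lookup (wt []) k ≡ 0ℤ
wt-[] = wt-lookup []

wt-++ : ∀ (x y : Word n) k → lookup (wt (x ++ y)) k ≡ lookup (wt x) k + lookup (wt y) k
wt-++ x y k = begin
  lookup (wt (x ++ y)) k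
    ≡⟨ wt-lookup (x ++ y) k ⟩
  + countᵇ (isPos k) (x ++ y) - + countᵇ (isNeg k) (x ++ y)
    ≡⟨ cong₂ (λ a b → + a - + b) (countᵇ-++ (isPos k) x y) (countᵇ-++ (isNeg k) x y) ⟩
  + (px ℕ.+ py) - + (nx ℕ.+ ny)
    ≡⟨ cong₂ _-_ (pos-+ px py) (pos-+ nx ny) ⟩
  (+ px + + py) - (+ nx + + ny)
    ≡⟨ regroup (+ px) (+ py) (+ nx) (+ ny) ⟩
  (+ px - + nx) + (+ py - + ny)
    ≡⟨ sym (cong₂ _+_ (wt-lookup x k) (wt-lookup y k)) ⟩
  lookup (wt x) k + lookup (wt y) k ∎
  where
  open ≡-Reasoning
  px py nx ny : ℕ
  px = countᵇ (isPos k) x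
  py = countᵇ (isPos k) y
  nx = countᵇ (isNeg k) x
  ny = countᵇ (isNeg k) y
  regroup : ∀ a b c d → (a + b) - (c + d) ≡ (a - c) + (b - d)
  regroup = solve-∀

wt-commute : ∀ (x y : Word n) → wt (x ++ y) ≡ wt (y ++ x)
wt-commute x y = lookup-extensionality λ k →
  trans (wt-++ x y k) (trans (ℤ.+-comm (lookup (wt x) k) _) (sym (wt-++ y x k)))

≢⇒≡ᵇ-false : ∀ {j k : Fin n} → j ≢ k → (toℕ j ≡ᵇ toℕ k) ≡ false
≢⇒≡ᵇ-false {j = j} {k} j≢k with toℕ j ≡ᵇ toℕ k in e
... | true = ⊥-elim (j≢k (toℕ-injective (≡ᵇ-sound e)))
... | false = refl

wt-pos-self : ∀ (j : Fin n) → lookup (wt [ pos j ]) j ≡ 1ℤ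
wt-pos-self j rewrite wt-lookup [ pos j ] j | ≡ᵇ-refl (toℕ j) = refl

wt-neg-self : ∀ (j : Fin n) → lookup (wt [ neg j ]) j ≡ -1ℤ
wt-neg-self j rewrite wt-lookup [ neg j ] j | ≡ᵇ-refl (toℕ j) = refl

wt-letter-other : ∀ (x : Letter n) k → index x ≢ k → lookup (wt [ x ]) k ≡ 0ℤ
wt-letter-other (pos j) k j≢k rewrite wt-lookup [ pos j ] k | ≢⇒≡ᵇ-false j≢k = refl
wt-letter-other (neg j) k j≢k rewrite wt-lookup [ neg j ] k | ≢⇒≡ᵇ-false j≢k = refl

wt-bar : ∀ (x : Letter n) k → lookup (wt [ bar x ]) k ≡ - lookup (wt [ x ]) k
wt-bar (pos j) k rewrite wt-lookup [ neg j ] k | wt-lookup [ pos j ] k with toℕ j ≡ᵇ toℕ k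
... | true = refl
... | false = refl
wt-bar (neg j) k rewrite wt-lookup [ pos j ] k | wt-lookup [ neg j ] k with toℕ j ≡ᵇ toℕ k
... | true = refl
... | false = refl

wt-replicate : ∀ m (x : Letter n) k → lookup (wt (replicate m x)) k ≡ + m * lookup (wt [ x ]) k
wt-replicate zero x k = wt-[] k
wt-replicate (suc m) x k =
  trans (wt-++ [ x ] (replicate m x) k)
        (trans (cong (λ c → lookup (wt [ x ]) k + c) (wt-replicate m x k))
               (sym (unfold (+ m) (lookup (wt [ x ]) k))))
  where
  unfold : ∀ a b → (+ 1 + a) * b ≡ b + a * b
  unfold = solve-∀

wt≢0⇒occurs : ∀ (w : Word n) k → lookup (wt w) k ≢ 0ℤ → ∃[ x ] (x ∈ w × index x ≡ k)
wt≢0⇒occurs [] k w≢0 = ⊥-elim (w≢0 (wt-[] k))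
wt≢0⇒occurs (x ∷ w) k w≢0 with index x ≟ k
... | yes e = x , here refl , e
... | no x≢k with wt≢0⇒occurs w k (w≢0 ∘ trans (wt-++ [ x ] w k) ∘ cong₂ _+_ (wt-letter-other x k x≢k))
...   | y , y∈w , ey = y , there y∈w , ey

-- The hypoplactic congruence

Preserves : (Word n → Word n) → Word n → Set
Preserves ψ x =
    wt (ψ x) ≡ wt x
  × (∀ i → ε̈ i (ψ x) ≡ ε̈ i x)
  × (∀ i → φ̈ i (ψ x) ≡ φ̈ i x)
  × (∀ i → ë i (ψ x) ≡ mapMaybe ψ (ë i x))
  × (∀ i → f̈ i (ψ x) ≡ mapMaybe ψ (f̈ i x))

∼̈-refl : ∀ (w : Word n) → w ∼̈ w
∼̈-refl w = (λ x → x) , refl , (λ _ r → r) , (λ _ _ _ _ e → e) , (λ y r → y , r , refl) ,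
  λ x _ → refl , (λ _ → refl) , (λ _ → refl) ,
          (λ i → sym (map-id (ë i x))) , (λ i → sym (map-id (f̈ i x)))

ε̈⇒hasInv : ∀ (i : Fin n) u v → ε̈ i u ≡ ε̈ i v → hasInv i u ≡ hasInv i v
ε̈⇒hasInv i u v e with hasInv i u | hasInv i v
... | true | true = refl
... | false | false = refl
ε̈⇒hasInv i u v () | true | false
ε̈⇒hasInv i u v () | false | true

∼̈⇒wt : ∀ {u v : Word n} → u ∼̈ v → wt u ≡ wt v
∼̈⇒wt (_ , refl , _ , _ , _ , preserves) = sym (proj₁ (preserves _ here))

∼̈⇒hasInv : ∀ {u v : Word n} → u ∼̈ v → ∀ i → hasInv i u ≡ hasInv i v
∼̈⇒hasInv {u = u} (ψ , refl , _ , _ , _ , preserves) i =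
  sym (ε̈⇒hasInv i (ψ u) u (proj₁ (proj₂ (preserves u here)) i))

∼̈⇒inv : ∀ {u v : Word n} → u ∼̈ v → inv u ≡ inv v
∼̈⇒inv u∼v = tabulate-cong (∼̈⇒hasInv u∼v)

lookup-inv : ∀ (w : Word n) i → lookup (inv w) i ≡ hasInv i w
lookup-inv w = lookup∘tabulate _

inert-ε̈ : ∀ (i : Fin n) w → Inert i w → ε̈ i w ≡ (if hasInv i w then ∞ else fin 0)
inert-ε̈ i w inert with hasInv i w
... | true = refl
... | false = cong fin (countᵇ-absent (isB i) w (proj₂ (inert refl)))

inert-φ̈ : ∀ (i : Fin n) w → Inert i w → φ̈ i w ≡ (if hasInv i w then ∞ else fin 0)
inert-φ̈ i w inert with hasInv i w
... | true = refl
... | false = cong fin (countᵇ-absent (isA i) w (proj₁ (inert refl)))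

inert-∼̈ : ∀ {u v : Word n} → (∀ i → Inert i u) → (∀ i → Inert i v) →
  wt u ≡ wt v → inv u ≡ inv v → u ∼̈ v
inert-∼̈ {u = u} {v} inert-u inert-v wt≡ inv≡ =
  (λ _ → v) , refl , (λ _ _ → here) , (λ x y rx ry _ → trans (isolated-u x rx) (sym (isolated-u y ry))) ,
  (λ y ry → u , here , sym (isolated-v y ry)) , preserves
  where
  isolated-u : Isolated u
  isolated-u = inert⇒isolated inert-u
  isolated-v : Isolated v
  isolated-v = inert⇒isolated inert-v
  hasInv≡ : ∀ i → hasInv i v ≡ hasInv i u
  hasInv≡ i = trans (sym (lookup-inv v i)) (trans (cong (λ δ → lookup δ i) (sym inv≡)) (lookup-inv u i))
  ∞-iff-inverted : ∀ i → (if hasInv i v then ∞ else fin 0) ≡ (if hasInv i u then ∞ else fin 0)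
  ∞-iff-inverted i = cong (λ b → if b then ∞ else fin 0) (hasInv≡ i)
  stuck-u : ∀ i → ë i u ≡ nothing × f̈ i u ≡ nothing
  stuck-u i = inert⇒stuck i u (inert-u i)
  stuck-v : ∀ i → ë i v ≡ nothing × f̈ i v ≡ nothing
  stuck-v i = inert⇒stuck i v (inert-v i)
  preserves : ∀ x → Reach u x → Preserves (λ _ → v) x
  preserves x r with isolated-u x r
  ... | refl =
      sym wt≡
    , (λ i → trans (inert-ε̈ i v (inert-v i)) (trans (∞-iff-inverted i) (sym (inert-ε̈ i u (inert-u i)))))
    , (λ i → trans (inert-φ̈ i v (inert-v i)) (trans (∞-iff-inverted i) (sym (inert-φ̈ i u (inert-u i)))))
    , (λ i → trans (proj₁ (stuck-v i)) (cong (mapMaybe _) (sym (proj₁ (stuck-u i)))))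
    , (λ i → trans (proj₂ (stuck-v i)) (cong (mapMaybe _) (sym (proj₂ (stuck-u i)))))

-- Central words

central⇒inert : ∀ {w : Word n} → Central w → ∀ i → Inert i w
central⇒inert {w = w} central i noInv = absentA , absentB
  where
  absentA : any (isA i) w ≡ false
  absentA with any (isA i) w in ea
  ... | false = refl
  ... | true = ⊥-elim (false≢true (begin
    false                       ≡⟨ sym noInv ⟩
    hasInv i w                  ≡⟨ sym (hasInv-∷-¬A i (neg i) w (n≡ᵇ1+n (toℕ i))) ⟩
    hasInv i (neg i ∷ w)        ≡⟨ ∼̈⇒hasInv (central [ neg i ]) i ⟩
    hasInv i (w ++ [ neg i ])   ≡⟨ hasInv-++-straddle i w [ neg i ] ea (cong (_∨ false) (≡ᵇ-refl (toℕ i))) ⟩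
    true                        ∎))
    where open ≡-Reasoning
  absentB : any (isB i) w ≡ false
  absentB with any (isB i) w in eb
  ... | false = refl
  ... | true = ⊥-elim (false≢true (begin
    false                       ≡⟨ sym noInv ⟩
    hasInv i w                  ≡⟨ sym (hasInv-∷ʳ-¬B i w (pos i) (n≡ᵇ1+n (toℕ i))) ⟩
    hasInv i (w ++ [ pos i ])   ≡⟨ sym (∼̈⇒hasInv (central [ pos i ]) i) ⟩
    hasInv i (pos i ∷ w)        ≡⟨ hasInv-++-straddle i [ pos i ] w (cong (_∨ false) (≡ᵇ-refl (toℕ i))) eb ⟩
    true                        ∎))
    where open ≡-Reasoning

module Transport {n : ℕ} (F G : Word n → Word n) (ë′ f̈′ : Fin n → Word n → Maybe (Word n))
  (ë-F : ∀ i x → ë i (F x) ≡ mapMaybe F (ë′ i x))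
  (f̈-F : ∀ i x → f̈ i (F x) ≡ mapMaybe F (f̈′ i x))
  (ë-G : ∀ i x → ë i (G x) ≡ mapMaybe G (ë′ i x))
  (f̈-G : ∀ i x → f̈ i (G x) ≡ mapMaybe G (f̈′ i x)) where

  private
    transport-step : ∀ (op op′ : Word n → Maybe (Word n)) →
      (∀ x → op (F x) ≡ mapMaybe F (op′ x)) → (∀ x → op (G x) ≡ mapMaybe G (op′ x)) →
      ∀ {x y} → op (F x) ≡ just y → ∃[ x′ ] (y ≡ F x′ × op (G x) ≡ just (G x′))
    transport-step op op′ op-F op-G {x} e with map-just⁻ {f = F} {m = op′ x} (trans (sym (op-F x)) e)
    ... | x′ , e′ , refl = x′ , refl , trans (op-G x) (cong (mapMaybe G) e′)

  transport : ∀ {u y} → Reach (F u) y → ∃[ x ] (y ≡ F x × Reach (G u) (G x))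
  transport here = _ , refl , here
  transport (step-e i r e) with transport r
  ... | x , refl , r′ with transport-step (ë i) (ë′ i) (ë-F i) (ë-G i) e
  ...   | x′ , refl , e′ = x′ , refl , step-e i r′ e′
  transport (step-f i r e) with transport r
  ... | x , refl , r′ with transport-step (f̈ i) (f̈′ i) (f̈-F i) (f̈-G i) e
  ...   | x′ , refl , e′ = x′ , refl , step-f i r′ e′

module _ {w : Word n} (inert : ∀ i → Inert i w) where

  hasInv-frameʳ : ∀ i x → hasInv i (x ++ w) ≡ hasInv i w ∨ hasInv i x
  hasInv-frameʳ i x rewrite hasInv-++ i x w with hasInv i w in e
  ... | true rewrite ∨-zeroʳ (any (isA i) x ∧ any (isB i) w) = ∨-zeroʳ (hasInv i x)
  ... | false rewrite proj₂ (inert i e) | ∧-zeroʳ (any (isA i) x) = ∨-identityʳ (hasInv i x)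

  hasInv-frameˡ : ∀ i x → hasInv i (w ++ x) ≡ hasInv i w ∨ hasInv i x
  hasInv-frameˡ i x rewrite hasInv-++ i w x with hasInv i w in e
  ... | true = refl
  ... | false rewrite proj₁ (inert i e) = refl

  private
    guarded-frame : ∀ i (F : Word n → Word n) (R : Word n → Maybe (Word n)) →
      (∀ x → hasInv i (F x) ≡ hasInv i w ∨ hasInv i x) →
      (hasInv i w ≡ false → ∀ x → R (F x) ≡ mapMaybe F (R x)) →
      ∀ x → (if hasInv i (F x) then nothing else R (F x))
          ≡ mapMaybe F (if hasInv i w then nothing else if hasInv i x then nothing else R x)
    guarded-frame i F R hasInv-F R-F x rewrite hasInv-F x with hasInv i w
    ... | true = refl
    ... | false with hasInv i x
    ...   | true = refl
    ...   | false = R-F refl x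

  -- The action of ë_i and f̈_i on x as seen inside x ++ w and w ++ x.
  ëʷ f̈ʷ : Fin n → Word n → Maybe (Word n)
  ëʷ i x = if hasInv i w then nothing else ë i x
  f̈ʷ i x = if hasInv i w then nothing else f̈ i x

  ë-frameʳ : ∀ i x → ë i (x ++ w) ≡ mapMaybe (_++ w) (ëʷ i x)
  ë-frameʳ i = guarded-frame i (_++ w) (replaceLast (isB i) (eL i)) (hasInv-frameʳ i)
    (λ e x → replaceLast-++ʳ (isB i) (eL i) x w (proj₂ (inert i e)))

  ë-frameˡ : ∀ i x → ë i (w ++ x) ≡ mapMaybe (w ++_) (ëʷ i x)
  ë-frameˡ i = guarded-frame i (w ++_) (replaceLast (isB i) (eL i)) (hasInv-frameˡ i)
    (λ e x → replaceLast-++ˡ (isB i) (eL i) w x (proj₂ (inert i e)))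

  f̈-frameʳ : ∀ i x → f̈ i (x ++ w) ≡ mapMaybe (_++ w) (f̈ʷ i x)
  f̈-frameʳ i = guarded-frame i (_++ w) (replaceFirst (isA i) (fL i)) (hasInv-frameʳ i)
    (λ e x → replaceFirst-++ʳ (isA i) (fL i) x w (proj₁ (inert i e)))

  f̈-frameˡ : ∀ i x → f̈ i (w ++ x) ≡ mapMaybe (w ++_) (f̈ʷ i x)
  f̈-frameˡ i = guarded-frame i (w ++_) (replaceFirst (isA i) (fL i)) (hasInv-frameˡ i)
    (λ e x → replaceFirst-++ˡ (isA i) (fL i) w x (proj₁ (inert i e)))

  open Transport (_++ w) (w ++_) ëʷ f̈ʷ ë-frameʳ f̈-frameʳ ë-frameˡ f̈-frameˡ renaming (transport to forward)
  open Transport (w ++_) (_++ w) ëʷ f̈ʷ ë-frameˡ f̈-frameˡ ë-frameʳ f̈-frameʳ renaming (transport to backward)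

  -- Only its values on words x ++ w matter; there it returns w ++ x.
  rotate : Word n → Word n
  rotate y = w ++ take (length y ∸ length w) y

  rotate-++ : ∀ x → rotate (x ++ w) ≡ w ++ x
  rotate-++ x rewrite length-++ x {w} | m+n∸n≡m (length x) (length w) = cong (w ++_) (take-++ x w)

  private
    rotate-commutes : ∀ (op op′ : Word n → Maybe (Word n)) →
      (∀ x → op (x ++ w) ≡ mapMaybe (_++ w) (op′ x)) → (∀ x → op (w ++ x) ≡ mapMaybe (w ++_) (op′ x)) →
      ∀ x → op (w ++ x) ≡ mapMaybe rotate (op (x ++ w))
    rotate-commutes op op′ op-ʳ op-ˡ x = begin
      op (w ++ x)                              ≡⟨ op-ˡ x ⟩
      mapMaybe (w ++_) (op′ x)                 ≡⟨ map-cong (sym ∘ rotate-++) (op′ x) ⟩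
      mapMaybe (rotate ∘ (_++ w)) (op′ x)      ≡⟨ map-∘ (op′ x) ⟩
      mapMaybe rotate (mapMaybe (_++ w) (op′ x)) ≡⟨ cong (mapMaybe rotate) (sym (op-ʳ x)) ⟩
      mapMaybe rotate (op (x ++ w))            ∎
      where open ≡-Reasoning

    countᵇ-commute : ∀ p x → countᵇ p (w ++ x) ≡ countᵇ p (x ++ w)
    countᵇ-commute p x = trans (countᵇ-++ p w x) (trans (ℕ.+-comm (countᵇ p w) _) (sym (countᵇ-++ p x w)))

    hasInv-commute : ∀ i x → hasInv i (w ++ x) ≡ hasInv i (x ++ w)
    hasInv-commute i x = trans (hasInv-frameˡ i x) (sym (hasInv-frameʳ i x))

  inert⇒central : Central w
  inert⇒central u = rotate , rotate-++ u , into , injective , onto , preserves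
    where
    into : ∀ y → Reach (u ++ w) y → Reach (w ++ u) (rotate y)
    into y r with forward r
    ... | x , refl , r′ rewrite rotate-++ x = r′
    injective : ∀ y y′ → Reach (u ++ w) y → Reach (u ++ w) y′ → rotate y ≡ rotate y′ → y ≡ y′
    injective y y′ r r′ e with forward r | forward r′
    ... | x , refl , _ | x′ , refl , _ rewrite rotate-++ x | rotate-++ x′ = cong (_++ w) (++-cancelˡ w x x′ e)
    onto : ∀ z → Reach (w ++ u) z → ∃[ y ] (Reach (u ++ w) y × rotate y ≡ z)
    onto z r with backward r
    ... | x , refl , r′ = x ++ w , r′ , rotate-++ x
    preserves : ∀ y → Reach (u ++ w) y → Preserves rotate y
    preserves y r with forward r
    ... | x , refl , _ rewrite rotate-++ x =
        wt-commute w x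
      , (λ i → cong₂ (λ h c → if h then ∞ else fin c) (hasInv-commute i x) (countᵇ-commute (isB i) x))
      , (λ i → cong₂ (λ h c → if h then ∞ else fin c) (hasInv-commute i x) (countᵇ-commute (isA i) x))
      , (λ i → rotate-commutes (ë i) (ëʷ i) (ë-frameʳ i) (ë-frameˡ i) x)
      , (λ i → rotate-commutes (f̈ i) (f̈ʷ i) (f̈-frameʳ i) (f̈-frameˡ i) x)

-- Admissible pairs

inert⇒admissible : ∀ {w : Word n} → (∀ i → Inert i w) → Admissible (wt w) (inv w)
inert⇒admissible {w = w} inert = occupied , connected
  where
  inv-touch : ∀ {i x} → x ∈ w → Touches i x → lookup (inv w) i ≡ true
  inv-touch {i} x∈w t = trans (lookup-inv w i) (inert-touch (inert i) x∈w t)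
  occupied : ∀ i → lookup (wt w) i ≢ 0ℤ →
    lookup (inv w) i ≡ true × (∀ j → suc (toℕ j) ≡ toℕ i → lookup (inv w) j ≡ true)
  occupied i w≢0 with wt≢0⇒occurs w i w≢0
  ... | x , x∈w , refl = inv-touch x∈w (touches-index x) , λ j e → inv-touch x∈w (touches-predecessor j x e)
  connected : ∀ i → 1 ℕ.≤ toℕ i → lookup (inv w) i ≡ true →
      (∃[ j ] (suc (toℕ j) ≡ toℕ i × lookup (inv w) j ≡ true))
    ⊎ (∃[ j ] (toℕ j ≡ suc (toℕ i) × lookup (inv w) j ≡ true))
  connected (suc i) _ inv-i with hasInv⇒A-letter (suc i) w (trans (sym (lookup-inv w (suc i))) inv-i)
  ... | pos k , x∈w , a = inj₁ (inject₁ i , cong suc (toℕ-inject₁ i) ,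
        inv-touch x∈w (touches-predecessor (inject₁ i) (pos k)
                        (trans (cong suc (toℕ-inject₁ i)) (sym (≡ᵇ-sound a)))))
  ... | neg k , x∈w , a = inj₂ (k , ≡ᵇ-sound a , inv-touch x∈w (touches-index (neg k)))

concatᶠ : ∀ {m} → (Fin m → Word n) → Word n
concatᶠ = Vector.foldr _++_ []

All-concatᶠ : ∀ {P : Letter n → Set} {m} (f : Fin m → Word n) → (∀ j → All P (f j)) → All P (concatᶠ f)
All-concatᶠ {m = zero} f _ = []
All-concatᶠ {m = suc m} f h = ++⁺ (h zero) (All-concatᶠ (f ∘ suc) (h ∘ suc))

hasInv-concatᶠ : ∀ (i : Fin n) {m} (f : Fin m → Word n) j →
  hasInv i (f j) ≡ true → hasInv i (concatᶠ f) ≡ true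
hasInv-concatᶠ i f zero e = hasInv-++ˡ i (f zero) _ e
hasInv-concatᶠ i f (suc j) e = hasInv-++ʳ i (f zero) _ (hasInv-concatᶠ i (f ∘ suc) j e)

wt-concatᶠ-zero : ∀ {m} (f : Fin m → Word n) k →
  (∀ j → lookup (wt (f j)) k ≡ 0ℤ) → lookup (wt (concatᶠ f)) k ≡ 0ℤ
wt-concatᶠ-zero {m = zero} f k _ = wt-[] k
wt-concatᶠ-zero {m = suc m} f k h =
  trans (wt-++ (f zero) _ k) (cong₂ _+_ (h zero) (wt-concatᶠ-zero (f ∘ suc) k (h ∘ suc)))

wt-concatᶠ-single : ∀ {m} (f : Fin m → Word n) j₀ k →
  (∀ j → j ≢ j₀ → lookup (wt (f j)) k ≡ 0ℤ) → lookup (wt (concatᶠ f)) k ≡ lookup (wt (f j₀)) k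
wt-concatᶠ-single f zero k h = begin
  lookup (wt (concatᶠ f)) k                           ≡⟨ wt-++ (f zero) _ k ⟩
  lookup (wt (f zero)) k + lookup (wt (concatᶠ (f ∘ suc))) k
    ≡⟨ cong (λ c → lookup (wt (f zero)) k + c) (wt-concatᶠ-zero (f ∘ suc) k (λ j → h (suc j) λ ())) ⟩
  lookup (wt (f zero)) k + 0ℤ                          ≡⟨ ℤ.+-identityʳ _ ⟩
  lookup (wt (f zero)) k                               ∎
  where open ≡-Reasoning
wt-concatᶠ-single f (suc j₀) k h = begin
  lookup (wt (concatᶠ f)) k                           ≡⟨ wt-++ (f zero) _ k ⟩
  lookup (wt (f zero)) k + lookup (wt (concatᶠ (f ∘ suc))) k
    ≡⟨ cong (_+ lookup (wt (concatᶠ (f ∘ suc))) k) (h zero λ ()) ⟩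
  0ℤ + lookup (wt (concatᶠ (f ∘ suc))) k               ≡⟨ ℤ.+-identityˡ _ ⟩
  lookup (wt (concatᶠ (f ∘ suc))) k
    ≡⟨ wt-concatᶠ-single (f ∘ suc) j₀ k (λ j j≢j₀ → h (suc j) (j≢j₀ ∘ Fin.suc-injective)) ⟩
  lookup (wt (f (suc j₀))) k                           ∎
  where open ≡-Reasoning

power : ℤ → Fin n → Word n
power (+ m) j = replicate m (pos j)
power -[1+ m ] j = replicate (suc m) (neg j)

wt-power-self : ∀ z (j : Fin n) → lookup (wt (power z j)) j ≡ z
wt-power-self (+ m) j =
  trans (wt-replicate m (pos j) j) (trans (cong (+ m *_) (wt-pos-self j)) (ℤ.*-identityʳ (+ m)))
wt-power-self -[1+ m ] j =
  trans (wt-replicate (suc m) (neg j) j)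
        (trans (cong (+ suc m *_) (wt-neg-self j)) (trans (ℤ.*-comm (+ suc m) -1ℤ) (ℤ.-1*i≡-i (+ suc m))))

wt-power-other : ∀ z {j k : Fin n} → j ≢ k → lookup (wt (power z j)) k ≡ 0ℤ
wt-power-other (+ m) {j} {k} j≢k =
  trans (wt-replicate m (pos j) k) (trans (cong (+ m *_) (wt-letter-other (pos j) k j≢k)) (ℤ.*-zeroʳ (+ m)))
wt-power-other -[1+ m ] {j} {k} j≢k =
  trans (wt-replicate (suc m) (neg j) k)
        (trans (cong (+ suc m *_) (wt-letter-other (neg j) k j≢k)) (ℤ.*-zeroʳ (+ suc m)))

All-power : ∀ {P : Fin n → Set} z j → (z ≢ 0ℤ → P j) → All (P ∘ index) (power z j)
All-power (+ zero) j _ = []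
All-power (+ suc m) j h = replicate⁺ (suc m) (h λ ())
All-power -[1+ m ] j h = replicate⁺ (suc m) (h λ ())

wt-dipole : ∀ (x : Letter n) k → lookup (wt (x ∷ bar x ∷ [])) k ≡ 0ℤ
wt-dipole x k = trans (wt-++ [ x ] [ bar x ] k)
  (trans (cong (λ c → lookup (wt [ x ]) k + c) (wt-bar x k)) (ℤ.+-inverseʳ (lookup (wt [ x ]) k)))

hasInv-dipole : ∀ (i : Fin n) x → isA i x ≡ true → hasInv i (x ∷ bar x ∷ []) ≡ true
hasInv-dipole i x a rewrite isB-bar i x | a = refl

Supported : Vec Bool n → Fin n → Set
Supported δ j = lookup δ j ≡ true × (∀ k → suc (toℕ k) ≡ toℕ j → lookup δ k ≡ true)

supported-touch : ∀ {δ : Vec Bool n} {k} x → Supported δ (index x) → Touches k x → lookup δ k ≡ true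
supported-touch x (δx , δpred) t with touches⇒index x t
... | inj₁ refl = δx
... | inj₂ e = δpred _ (sym e)

module Realisation {n : ℕ} (lam : Vec ℤ n) (δ : Vec Bool n) (adm : Admissible lam δ) where

  -- Condition (2) of admissibility decides between the letters i and overline{i+1}.
  anchor : ∀ i → lookup δ i ≡ true → ∃[ x ] (isA i x ≡ true × Supported δ (index x))
  anchor zero δi = pos zero , refl , δi , λ _ ()
  anchor (suc i) δi with proj₂ adm (suc i) (s≤s z≤n) δi
  ... | inj₁ (j , ej , δj) = pos (suc i) , ≡ᵇ-refl (suc (toℕ i)) , δi ,
        λ k ek → subst (λ t → lookup δ t ≡ true) (toℕ-injective (ℕ.suc-injective (trans ej (sym ek)))) δj
  ... | inj₂ (j , ej , δj) = neg j , ≡ᵇ-complete ej , δj ,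
        λ k ek → subst (λ t → lookup δ t ≡ true) (toℕ-injective (ℕ.suc-injective (trans (sym ej) (sym ek)))) δi

  record Block (i : Fin n) : Set where
    field
      word : Word n
      supported : All (Supported δ ∘ index) word
      balanced : ∀ k → lookup (wt word) k ≡ 0ℤ
      inverted : lookup δ i ≡ true → hasInv i word ≡ true

  block : ∀ i → Block i
  block i with lookup δ i in δi
  ... | false = record
    { word = []
    ; supported = []
    ; balanced = wt-[]
    ; inverted = λ δi′ → ⊥-elim (false≢true (trans (sym δi) δi′))
    }
  ... | true with anchor i δi
  ...   | x , a , s = record
    { word = x ∷ bar x ∷ []
    ; supported = s ∷ subst (Supported δ) (sym (index-bar x)) s ∷ []
    ; balanced = wt-dipole x
    ; inverted = λ _ → hasInv-dipole i x a
    }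

  segment : Fin n → Word n
  segment i = Block.word (block i) ++ power (lookup lam i) i

  realisation : Word n
  realisation = concatᶠ segment

  realisation-supported : All (Supported δ ∘ index) realisation
  realisation-supported = All-concatᶠ segment λ i →
    ++⁺ (Block.supported (block i)) (All-power (lookup lam i) i (proj₁ adm i))

  touched⇒δ : ∀ {i x} → x ∈ realisation → Touches i x → lookup δ i ≡ true
  touched⇒δ {i} {x} x∈ = supported-touch {δ = δ} {k = i} x (All.lookup realisation-supported x∈)

  hasInv-realisation : ∀ i → hasInv i realisation ≡ lookup δ i
  hasInv-realisation i with lookup δ i in δi
  ... | true = hasInv-concatᶠ i segment i (hasInv-++ˡ i (Block.word (block i)) _ (Block.inverted (block i) δi))
  ... | false with hasInv i realisation in e
  ...   | false = refl
  ...   | true with hasInv⇒A-letter i realisation e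
  ...     | x , x∈ , a = ⊥-elim (false≢true (trans (sym δi) (touched⇒δ x∈ (inj₁ a))))

  realisation-inert : ∀ i → Inert i realisation
  realisation-inert i noInv = absent (isA i) inj₁ , absent (isB i) inj₂
    where
    absent : ∀ p → (∀ {x} → p x ≡ true → Touches i x) → any p realisation ≡ false
    absent p touch with any p realisation in e
    ... | false = refl
    ... | true with any⇒∈ e
    ...   | x , x∈ , px =
      ⊥-elim (false≢true (trans (sym noInv) (trans (hasInv-realisation i) (touched⇒δ x∈ (touch px)))))

  wt-realisation : wt realisation ≡ lam
  wt-realisation = lookup-extensionality λ k → trans (wt-concatᶠ-single segment k k (other k)) (self k)
    where
    other : ∀ k j → j ≢ k → lookup (wt (segment j)) k ≡ 0ℤ
    other k j j≢k = trans (wt-++ (Block.word (block j)) _ k)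
      (cong₂ _+_ (Block.balanced (block j) k) (wt-power-other (lookup lam j) j≢k))
    self : ∀ k → lookup (wt (segment k)) k ≡ lookup lam k
    self k = trans (wt-++ (Block.word (block k)) _ k)
      (trans (cong₂ _+_ (Block.balanced (block k) k) (wt-power-self (lookup lam k) k)) (ℤ.+-identityˡ _))

  inv-realisation : inv realisation ≡ δ
  inv-realisation = lookup-extensionality λ i → trans (lookup-inv realisation i) (hasInv-realisation i)

theorem9p21 : (n : ℕ) → 2 ℕ.≤ n →
    (∀ (w : Word n) → Central w → ∃[ v ] (Isolated v × v ∼̈ w))
  × (∀ (u v : Word n) → Isolated u → Isolated v → Central u → Central v →
       u ∼̈ v → wt u ≡ wt v × inv u ≡ inv v)
  × (∀ (u v : Word n) → Isolated u → Isolated v → Central u → Central v →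
       wt u ≡ wt v → inv u ≡ inv v → u ∼̈ v)
  × (∀ (w : Word n) → Isolated w → Central w → Admissible (wt w) (inv w))
  × (∀ (lam : Vec ℤ n) (δ : Vec Bool n) → Admissible lam δ →
       ∃[ w ] (Isolated w × Central w × wt w ≡ lam × inv w ≡ δ))
theorem9p21 n _ =
    (λ w central → w , inert⇒isolated (central⇒inert {w = w} central) , ∼̈-refl w)
  , (λ u v _ _ _ _ u∼v → ∼̈⇒wt u∼v , ∼̈⇒inv u∼v)
  , (λ u v isolated-u isolated-v _ _ → inert-∼̈ (isolated⇒inert isolated-u) (isolated⇒inert isolated-v))
  , (λ w isolated _ → inert⇒admissible {w = w} (isolated⇒inert isolated))
  , λ lam δ adm → let open Realisation lam δ adm in
        realisation , inert⇒isolated realisation-inert , inert⇒central realisation-inert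
      , wt-realisation , inv-realisation
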